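{- Let $\mathcal{H}$ be a $k$-uniform hypergraph and let $G$ be its vertex-edge incidence graph. If $\mathcal{H}$ is 2-colorable, then $\operatorname{dal}(G)\le 2$.
   Context: The vertex-edge incidence graph of a hypergraph $\mathcal{H}$ is the bipartite graph with vertex set $V(\mathcal{H})\cup E(\mathcal{H})$ in which $v\in V(\mathcal{H})$ and $e\in E(\mathcal{H})$ are adjacent iff $v\in e$. $\mathcal{H}$ is 2-colorable if there is a coloring of $V(\mathcal{H})$ with 2 colors such that no hyperedge is monochromatic. For an edge-coloring $c:E(G)\to\{1,\dots,k\}$ (not necessarily proper), let $\bar c(v)=(a_1,\dots,a_k)$ where $a_i$ is the number of edges at $v$ of color $i$, and let $c^*(v)$ be $\bar c(v)$ sorted in nonincreasing order; $c$ is color-blind distinguishing if $c^*(u)\neq c^*(v)$ for every edge $uv$. $\operatorname{dal}(G)$ is the least $k$ for which such a coloring with colors $\{1,\dots,k\}$ exists ($\infty$ if none). -}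

module Defs where

open import Data.Nat using (ℕ; zero; suc; _+_; _≤_)
open import Data.Nat.Properties using (≤-decTotalOrder)
open import Data.Bool using (Bool; true; false; _∧_; if_then_else_)
open import Data.Fin using (Fin; splitAt)
open import Data.Fin.Properties using (_≟_)
open import Data.Fin.Subset using (Subset; _∈_; ∣_∣)
open import Data.List using (List; map; allFin)
open import Data.Vec using (lookup)
open import Data.Sum using (_⊎_; inj₁; inj₂)
open import Data.Product using (Σ; Σ-syntax; _×_; ∃-syntax; _,_)
open import Function.Definitions using (Injective)
open import Relation.Nullary using (¬_; ⌊_⌋)
open import Relation.Binary.PropositionalEquality using (_≡_; _≢_; refl)
import Relation.Binary.Construct.Flip.EqAndOrd as Flip
import Data.List.Sort as Sort

record Graph : Set where
  field
    N       : ℕ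
    Adj     : Fin N → Fin N → Bool
    sym     : ∀ u v → Adj u v ≡ Adj v u
    irrefl  : ∀ v → Adj v v ≡ false
open Graph public

countTrue : ∀ {N} → (Fin N → Bool) → ℕ
countTrue {zero}  p = 0
countTrue {suc N} p = (if p Fin.zero then 1 else 0) + countTrue (λ x → p (Fin.suc x))
  where import Data.Fin as Fin

-- An edge-colouring of G with colours Fin k (colour i+1 of the paper is
-- Fin index i): a colour for each ordered pair, required to agree on the
-- two orientations of every edge; values on non-edges are irrelevant.
EdgeColoring : Graph → ℕ → Set
EdgeColoring G k =
  Σ[ c ∈ (Fin (N G) → Fin (N G) → Fin k) ]
    (∀ u v → Adj G u v ≡ true → c u v ≡ c v u)

colorCount : (G : Graph) {k : ℕ} → EdgeColoring G k → Fin (N G) → Fin k → ℕ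
colorCount G (c , _) v i = countTrue (λ u → Adj G v u ∧ ⌊ c v u ≟ i ⌋)

cbar : (G : Graph) {k : ℕ} → EdgeColoring G k → Fin (N G) → List ℕ
cbar G {k} c v = map (colorCount G c v) (allFin k)

-- sorting in nonincreasing order
open Sort (Flip.decTotalOrder ≤-decTotalOrder) using (sort)

cstar : (G : Graph) {k : ℕ} → EdgeColoring G k → Fin (N G) → List ℕ
cstar G c v = sort (cbar G c v)

ColorBlindDistinguishing : (G : Graph) {k : ℕ} → EdgeColoring G k → Set
ColorBlindDistinguishing G c =
  ∀ u v → Adj G u v ≡ true → cstar G c u ≢ cstar G c v

-- dal(G) ≤ d : some k with 1 ≤ k ≤ d admits a colour-blind
-- distinguishing colouring with colours {1,…,k}
DalAtMost : Graph → ℕ → Set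
DalAtMost G d =
  ∃[ k ] (1 ≤ k × k ≤ d ×
    Σ[ c ∈ EdgeColoring G k ] ColorBlindDistinguishing G c)

record Hypergraph : Set where
  field
    n        : ℕ
    m        : ℕ
    edge     : Fin m → Subset n
    distinct : Injective _≡_ _≡_ edge
open Hypergraph public

Uniform : ℕ → Hypergraph → Set
Uniform k H = ∀ e → ∣ edge H e ∣ ≡ k

Monochromatic : (H : Hypergraph) → (Fin (n H) → Fin 2) → Fin (m H) → Set
Monochromatic H f e = ∃[ col ] (∀ v → v ∈ edge H e → f v ≡ col)

TwoColorable : Hypergraph → Set
TwoColorable H =
  ∃[ f ] (∀ e → ¬ Monochromatic H f e)

-- Vertex-edge incidence graph: vertices Fin (n + m); the first n are
-- the vertices of H, the last m its hyperedges.

incAdj : (H : Hypergraph) → Fin (n H + m H) → Fin (n H + m H) → Bool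
incAdj H x y with splitAt (n H) x | splitAt (n H) y
... | inj₁ v | inj₂ e = lookup (edge H e) v
... | inj₂ e | inj₁ v = lookup (edge H e) v
... | inj₁ _ | inj₁ _ = false
... | inj₂ _ | inj₂ _ = false

incAdj-sym : (H : Hypergraph) → ∀ x y → incAdj H x y ≡ incAdj H y x
incAdj-sym H x y with splitAt (n H) x | splitAt (n H) y
... | inj₁ v | inj₂ e = refl
... | inj₂ e | inj₁ v = refl
... | inj₁ _ | inj₁ _ = refl
... | inj₂ _ | inj₂ _ = refl

incAdj-irrefl : (H : Hypergraph) → ∀ x → incAdj H x x ≡ false
incAdj-irrefl H x with splitAt (n H) x
... | inj₁ _ = refl
... | inj₂ _ = refl

IncidenceGraph : Hypergraph → Graph
IncidenceGraph H = record
  { N = n H + m H ; Adj = incAdj H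
  ; sym = incAdj-sym H ; irrefl = incAdj-irrefl H }

-- Colour each incidence v ∈ e with the colour of v in a proper 2-colouring
-- of H. A vertex of H then sees only its own colour, so its sorted colour
-- vector contains a 0, whereas a hyperedge is not monochromatic and so sees
-- both colours. Adjacent vertices of the incidence graph are a vertex and a
-- hyperedge, hence get different sorted vectors.
module Submission where

open import Defs
open import Data.Nat using (ℕ; zero; suc; _+_; s≤s; z≤n)
open import Data.Nat.Properties using (≤-decTotalOrder)
open import Data.Bool using (Bool; true; false; _∧_)
open import Data.Bool.Properties using (∧-zeroʳ)
open import Data.Fin using (Fin; splitAt; _↑ˡ_; opposite) renaming (zero to fz; suc to fs)
open import Data.Fin.Properties using (_≟_; splitAt-↑ˡ; ¬∀⟶∃¬)
open import Data.Fin.Subset using (_∈_)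
open import Data.Fin.Subset.Properties using (_∈?_)
open import Data.List.Membership.Propositional.Properties using (∈-map⁺; ∈-map⁻; ∈-allFin)
open import Data.List.Relation.Binary.Permutation.Propositional using (↭-sym)
open import Data.List.Relation.Binary.Permutation.Propositional.Properties using (∈-resp-↭)
open import Data.Vec.Properties using ([]=⇒lookup)
open import Data.Sum using (_⊎_; inj₁; inj₂)
open import Data.Product using (_×_; _,_; ∃-syntax)
open import Relation.Nullary using (¬_; ⌊_⌋; yes; no; contradiction)
open import Relation.Nullary.Decidable using (_→-dec_)
open import Relation.Binary.PropositionalEquality using (_≡_; _≢_; refl; subst; ≢-sym) renaming (sym to ≡-sym)
import Data.List.Membership.Propositional as ListMembership
import Relation.Binary.Construct.Flip.EqAndOrd as Flip
open import Data.List.Sort (Flip.decTotalOrder ≤-decTotalOrder) using (sort-↭)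

countTrue≡0 : ∀ {N} (p : Fin N → Bool) → (∀ x → p x ≡ false) → countTrue p ≡ 0
countTrue≡0 {zero}  p p≡false = refl
countTrue≡0 {suc N} p p≡false rewrite p≡false fz =
  countTrue≡0 (λ x → p (fs x)) (λ x → p≡false (fs x))

countTrue≢0 : ∀ {N} (p : Fin N → Bool) (x : Fin N) → p x ≡ true → countTrue p ≢ 0
countTrue≢0 p fz px≡true rewrite px≡true = λ ()
countTrue≢0 p (fs x) px≡true with p fz
... | true  = λ ()
... | false = countTrue≢0 (λ y → p (fs y)) x px≡true

opposite-≢ : (i : Fin 2) → opposite i ≢ i
opposite-≢ fz      ()
opposite-≢ (fs fz) ()

≢-opposite⇒≡ : {a i : Fin 2} → a ≢ opposite i → a ≡ i
≢-opposite⇒≡ {fz}    {fz}    _ = refl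
≢-opposite⇒≡ {fz}    {fs fz} a≢ = contradiction refl a≢
≢-opposite⇒≡ {fs fz} {fz}    a≢ = contradiction refl a≢
≢-opposite⇒≡ {fs fz} {fs fz} _ = refl

MissesAColour : (G : Graph) {k : ℕ} → EdgeColoring G k → Fin (N G) → Set
MissesAColour G c v = ∃[ i ] colorCount G c v i ≡ 0

module _ (G : Graph) {k : ℕ} (c : EdgeColoring G k) where
  open ListMembership using () renaming (_∈_ to _∈ˡ_)

  MissesAColour⇒0∈cstar : ∀ v → MissesAColour G c v → 0 ∈ˡ cstar G c v
  MissesAColour⇒0∈cstar v (i , count≡0) =
    ∈-resp-↭ (↭-sym (sort-↭ _)) (subst (_∈ˡ cbar G c v) count≡0 (∈-map⁺ _ (∈-allFin i)))

  0∈cstar⇒MissesAColour : ∀ v → 0 ∈ˡ cstar G c v → MissesAColour G c v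
  0∈cstar⇒MissesAColour v 0∈ with i , _ , 0≡count ← ∈-map⁻ _ (∈-resp-↭ (sort-↭ _) 0∈) =
    i , ≡-sym 0≡count

  cstar-resp-MissesAColour : ∀ {u v} → cstar G c u ≡ cstar G c v →
                             MissesAColour G c u → MissesAColour G c v
  cstar-resp-MissesAColour {u} {v} eq missing =
    0∈cstar⇒MissesAColour v (subst (0 ∈ˡ_) eq (MissesAColour⇒0∈cstar u missing))

¬Monochromatic⇒colour∈ : (H : Hypergraph) (f : Fin (n H) → Fin 2) (e : Fin (m H)) →
                         ¬ Monochromatic H f e → ∀ i → ∃[ v ] (v ∈ edge H e × f v ≡ i)
¬Monochromatic⇒colour∈ H f e notMono i
  with v , ¬[v∈e→opposite] ← ¬∀⟶∃¬ (n H) (λ v → v ∈ edge H e → f v ≡ opposite i)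
         (λ v → (v ∈? edge H e) →-dec (f v ≟ opposite i))
         (λ allOpposite → notMono (opposite i , allOpposite))
  with v ∈? edge H e
... | yes v∈e = v , v∈e , ≢-opposite⇒≡ (λ fv≡ → ¬[v∈e→opposite] (λ _ → fv≡))
... | no  v∉e = contradiction (λ v∈e → contradiction v∈e v∉e) ¬[v∈e→opposite]

VertexEdgePair : (H : Hypergraph) → Fin (n H + m H) → Fin (n H + m H) → Set
VertexEdgePair H x y =
  ∃[ v ] ∃[ e ] (splitAt (n H) x ≡ inj₁ v × splitAt (n H) y ≡ inj₂ e)

incAdj⇒vertex-edge : (H : Hypergraph) → ∀ x y → incAdj H x y ≡ true →
                     VertexEdgePair H x y ⊎ VertexEdgePair H y x
incAdj⇒vertex-edge H x y adj with splitAt (n H) x | splitAt (n H) y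
... | inj₁ v | inj₂ e = inj₁ (v , e , refl , refl)
... | inj₂ e | inj₁ v = inj₂ (v , e , refl , refl)
... | inj₁ _ | inj₁ _ = contradiction adj λ ()
... | inj₂ _ | inj₂ _ = contradiction adj λ ()

module _ (H : Hypergraph) (f : Fin (n H) → Fin 2) where

  colourOfVertexEnd : Fin (n H + m H) → Fin (n H + m H) → Fin 2
  colourOfVertexEnd x y with splitAt (n H) x | splitAt (n H) y
  ... | inj₁ v | _      = f v
  ... | inj₂ _ | inj₁ v = f v
  ... | inj₂ _ | inj₂ _ = fz

  colourOfVertexEnd-sym : ∀ x y → incAdj H x y ≡ true →
                          colourOfVertexEnd x y ≡ colourOfVertexEnd y x
  colourOfVertexEnd-sym x y adj with splitAt (n H) x | splitAt (n H) y
  ... | inj₁ _ | inj₂ _ = refl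
  ... | inj₂ _ | inj₁ _ = refl
  ... | inj₁ _ | inj₁ _ = contradiction adj λ ()
  ... | inj₂ _ | inj₂ _ = contradiction adj λ ()

  incidenceColoring : EdgeColoring (IncidenceGraph H) 2
  incidenceColoring = colourOfVertexEnd , colourOfVertexEnd-sym

  private
    G = IncidenceGraph H
    C = incidenceColoring

  vertex-misses-opposite : ∀ x v → splitAt (n H) x ≡ inj₁ v →
                           colorCount G C x (opposite (f v)) ≡ 0
  vertex-misses-opposite x v x≡v = countTrue≡0 _ noIncidence
    where
    noIncidence : ∀ y → (incAdj H x y ∧ ⌊ colourOfVertexEnd x y ≟ opposite (f v) ⌋) ≡ false
    noIncidence y rewrite x≡v with f v ≟ opposite (f v)
    ... | yes fv≡ = contradiction (≡-sym fv≡) (opposite-≢ (f v))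
    ... | no  _   = ∧-zeroʳ _

  edge-sees-every-colour : ∀ x e → splitAt (n H) x ≡ inj₂ e → ¬ Monochromatic H f e →
                           ¬ MissesAColour G C x
  edge-sees-every-colour x e x≡e notMono (i , count≡0)
    with v , v∈e , fv≡i ← ¬Monochromatic⇒colour∈ H f e notMono i =
    countTrue≢0 _ (v ↑ˡ m H) incidence count≡0
    where
    incidence : (incAdj H x (v ↑ˡ m H) ∧ ⌊ colourOfVertexEnd x (v ↑ˡ m H) ≟ i ⌋) ≡ true
    incidence rewrite x≡e | splitAt-↑ˡ (n H) v (m H) | []=⇒lookup v∈e | fv≡i with i ≟ i
    ... | yes _  = refl
    ... | no i≢i = contradiction refl i≢i

  vertex≢edge : (∀ e → ¬ Monochromatic H f e) →
                ∀ x y v e → splitAt (n H) x ≡ inj₁ v → splitAt (n H) y ≡ inj₂ e →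
                cstar G C x ≢ cstar G C y
  vertex≢edge proper x y v e x≡v y≡e eq =
    edge-sees-every-colour y e y≡e (proper e)
      (cstar-resp-MissesAColour G C eq (opposite (f v) , vertex-misses-opposite x v x≡v))

  incidenceColoring-distinguishing : (∀ e → ¬ Monochromatic H f e) →
                                     ColorBlindDistinguishing G C
  incidenceColoring-distinguishing proper x y adj with incAdj⇒vertex-edge H x y adj
  ... | inj₁ (v , e , x≡v , y≡e) = vertex≢edge proper x y v e x≡v y≡e
  ... | inj₂ (v , e , y≡v , x≡e) = ≢-sym (vertex≢edge proper y x v e y≡v x≡e)

proposition6 : (k : ℕ) (H : Hypergraph) → Uniform k H → TwoColorable H →
    DalAtMost (IncidenceGraph H) 2
proposition6 _ H _ (f , proper) =
  2 , s≤s z≤n , s≤s (s≤s z≤n) ,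
  incidenceColoring H f , incidenceColoring-distinguishing H f proper
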